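{- Let $A,B,C,D$ be sets with $B$ and $D$ finite, let $f:A+C\to B+D$ be a bijection and $g:C\to D$ a bijection. Using the subtraction operation defined in the context, where subtraction of a bijection $C\to D$ from $f$ yields a bijection $A\to B$ and subtraction of a bijection $A\to B$ from $f$ (regarded as $C+A\to D+B$) yields a bijection $C\to D$, we have \[ f\setminus\bigl(f\setminus(f\setminus g)\bigr)=f\setminus g \quad\text{and}\quad f\setminus\Bigl(f\setminus\bigl(f\setminus(f\setminus g)\bigr)\Bigr)=f\setminus(f\setminus g).\]
   Context: $+$ denotes disjoint union. Subtraction: given sets $X_1,X_2,Y_1,Y_2$ with $Y_2$ finite, a bijection $\varphi:X_1+X_2\to Y_1+Y_2$ and a bijection $\psi:X_2\to Y_2$, $(\varphi\setminus\psi)(x)$ for $x\in X_1$ is computed by: set $y:=\varphi(x)$; while $y\in Y_2$, set $y:=\varphi(\psi^{ -1}(y))$; return $y$. It is known that this loop terminates and $\varphi\setminus\psi$ is a bijection $X_1\to Y_1$. -}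

module Defs where

open import Data.Sum.Base using (_⊎_; inj₁; inj₂; swap)
open import Function.Base using (_∘_)
open import Function.Bundles using (_↔_; Inverse)

-- Big-step semantics of the subtraction loop for φ : X₁ + X₂ → Y₁ + Y₂
-- and ψ : X₂ ↔ Y₂ :  Loop φ ψ y r  means "starting the loop with the
-- current value y, the loop terminates and returns r".
--   while y ∈ Y₂ : y := φ (ψ⁻¹ y);  return y
data Loop {X₁ X₂ Y₁ Y₂ : Set} (φ : X₁ ⊎ X₂ → Y₁ ⊎ Y₂) (ψ : X₂ ↔ Y₂)
          : Y₁ ⊎ Y₂ → Y₁ → Set where
  stop : ∀ {r} → Loop φ ψ (inj₁ r) r
  step : ∀ {d r} → Loop φ ψ (φ (inj₂ (Inverse.from ψ d))) r
                 → Loop φ ψ (inj₂ d) r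

IsSub : {X₁ X₂ Y₁ Y₂ : Set} → (X₁ ⊎ X₂ → Y₁ ⊎ Y₂) → (X₂ ↔ Y₂) → (X₁ ↔ Y₁) → Set
IsSub {X₁} φ ψ h = (x : X₁) → Loop φ ψ (φ (inj₁ x)) (Inverse.to h x)

flipSum : {X₁ X₂ Y₁ Y₂ : Set} → (X₁ ⊎ X₂ → Y₁ ⊎ Y₂) → (X₂ ⊎ X₁ → Y₂ ⊎ Y₁)
flipSum φ = swap ∘ φ ∘ swap

-- Let h : A ↔ B agree with f wherever f maps A into B, as f ∖ g does; then
-- f ∖ (f ∖ h) = h, which gives both identities (the second with f read as
-- C + A → D + B). If f(a) = d ∈ D, put c = (f ∖ h)⁻¹(d). The loop computing
-- (f ∖ h)(c) cannot stop at f(c), since then f(c) = d = f(a); so f(c) = b ∈ B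
-- and the loop continues at f(h⁻¹ b). This cannot lie in B, for then it is b
-- and the loop would cycle; so it is d, whence h⁻¹ b = a. The loop computing
-- (f ∖ (f ∖ h))(a) thus goes from d through c to f(c) = h(a).
module Submission where

open import Defs
open import Data.Nat.Base using (ℕ)
open import Data.Fin.Base using (Fin)
open import Data.Sum.Base using (_⊎_; inj₁; inj₂; swap)
open import Data.Sum.Properties using (inj₁-injective; swap-involutive; swap-↔)
open import Data.Product.Base using (_×_; ∃; _,_)
open import Data.Empty using (⊥; ⊥-elim)
open import Function.Base using (_∘_)
open import Function.Bundles using (_↔_; Inverse; Injection)
open import Function.Definitions using (Injective)
open import Function.Properties.Inverse using (↔⇒↣)
open import Relation.Binary.PropositionalEquality
  using (_≡_; refl; sym; trans; cong; subst)

open Inverse using (to; from; strictlyInverseˡ)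

module _ {X₁ X₂ Y₁ Y₂ : Set} {φ : X₁ ⊎ X₂ → Y₁ ⊎ Y₂} {ψ : X₂ ↔ Y₂} where

  Loop-stop⁻¹ : ∀ {y r b} → Loop φ ψ y r → y ≡ inj₁ b → r ≡ b
  Loop-stop⁻¹ stop refl = refl

  Loop-step⁻¹ : ∀ {y r d} → Loop φ ψ y r → y ≡ inj₂ d
              → Loop φ ψ (φ (inj₂ (from ψ d))) r
  Loop-step⁻¹ (step L) refl = L

  Loop-¬fixed : ∀ {y r d} → Loop φ ψ y r → y ≡ inj₂ d
              → φ (inj₂ (from ψ d)) ≡ inj₂ d → ⊥
  Loop-¬fixed (step L) refl fixed = Loop-¬fixed L fixed fixed

  Loop-cong : ∀ {φ′ y r} → (∀ z → φ z ≡ φ′ z) → Loop φ ψ y r → Loop φ′ ψ y r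
  Loop-cong eq stop     = stop
  Loop-cong eq (step L) = step (subst (λ y → Loop _ ψ y _) (eq _) (Loop-cong eq L))

  IsSub-cong : ∀ {φ′ h} → (∀ z → φ z ≡ φ′ z) → IsSub φ ψ h → IsSub φ′ ψ h
  IsSub-cong eq sub x = subst (λ y → Loop _ ψ y _) (eq (inj₁ x)) (Loop-cong eq (sub x))

flipSum-involutive : {X₁ X₂ Y₁ Y₂ : Set} (φ : X₁ ⊎ X₂ → Y₁ ⊎ Y₂)
                   → ∀ z → φ z ≡ flipSum (flipSum φ) z
flipSum-involutive φ z = sym (trans (swap-involutive _) (cong φ (swap-involutive z)))

flipSum-injective : {X₁ X₂ Y₁ Y₂ : Set} {φ : X₁ ⊎ X₂ → Y₁ ⊎ Y₂}
                  → Injective _≡_ _≡_ φ → Injective _≡_ _≡_ (flipSum φ)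
flipSum-injective φ-inj = swap-injective ∘ φ-inj ∘ swap-injective
  where
  swap-injective : {A B : Set} → Injective _≡_ _≡_ (swap {A = A} {B = B})
  swap-injective = Injection.injective (↔⇒↣ swap-↔)

module _ {X₁ X₂ Y₁ Y₂ : Set}
         (φ : X₁ ⊎ X₂ → Y₁ ⊎ Y₂) (φ-inj : Injective _≡_ _≡_ φ)
         (ψ : X₁ ↔ Y₁) (ψ-agrees : ∀ {x y} → φ (inj₁ x) ≡ inj₁ y → to ψ x ≡ y)
         (χ : X₂ ↔ Y₂) (χ-sub : IsSub (flipSum φ) ψ χ) where

  private
    χ-loop : ∀ d → Loop (flipSum φ) ψ (swap (φ (inj₂ (from χ d)))) d
    χ-loop d = subst (Loop _ ψ _) (strictlyInverseˡ χ d) (χ-sub (from χ d))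

    inj₁≢inj₂ : ∀ {A B : Set} {a : A} {b : B} → inj₁ a ≡ inj₂ b → ⊥
    inj₁≢inj₂ ()

  sub-crossing : ∀ {a d} → φ (inj₁ a) ≡ inj₂ d → φ (inj₂ (from χ d)) ≡ inj₁ (to ψ a)
  sub-crossing {a} {d} φa with φ (inj₂ (from χ d)) in φc
  ... | inj₂ _ = ⊥-elim (inj₁≢inj₂ (φ-inj (trans φa (sym φc≡d))))
    where
    φc≡d : φ (inj₂ (from χ d)) ≡ inj₂ d
    φc≡d = trans φc (cong inj₂ (sym (Loop-stop⁻¹ (χ-loop d) (cong swap φc))))
  ... | inj₁ b with φ (inj₁ (from ψ b)) in φa′
  ...   | inj₂ _ = cong inj₁ (trans (sym (strictlyInverseˡ ψ b)) (cong (to ψ) a′≡a))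
    where
    φa′≡d : φ (inj₁ (from ψ b)) ≡ inj₂ d
    φa′≡d = trans φa′ (cong inj₂ (sym (Loop-stop⁻¹
              (Loop-step⁻¹ (χ-loop d) (cong swap φc)) (cong swap φa′))))
    a′≡a : from ψ b ≡ a
    a′≡a = inj₁-injective (φ-inj (trans φa′≡d (sym φa)))
  ...   | inj₁ _ = ⊥-elim (Loop-¬fixed (χ-loop d) (cong swap φc) (cong swap φa′≡b))
    where
    φa′≡b : φ (inj₁ (from ψ b)) ≡ inj₁ b
    φa′≡b = trans φa′ (cong inj₁ (trans (sym (ψ-agrees φa′)) (strictlyInverseˡ ψ b)))

  sub-flip-sub : (θ : X₁ ↔ Y₁) → IsSub φ χ θ → ∀ a → to θ a ≡ to ψ a
  sub-flip-sub θ θ-sub a with φ (inj₁ a) in φa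
  ... | inj₁ b = trans (Loop-stop⁻¹ (θ-sub a) φa) (sym (ψ-agrees φa))
  ... | inj₂ d = Loop-stop⁻¹ (Loop-step⁻¹ (θ-sub a) φa) (sub-crossing φa)

proposition6 : {A B C D : Set}
    → (∃ λ (n : ℕ) → B ↔ Fin n) → (∃ λ (m : ℕ) → D ↔ Fin m)
    → (f : (A ⊎ C) ↔ (B ⊎ D)) → (g : C ↔ D)
    → (h₁ : A ↔ B) → IsSub (Inverse.to f) g h₁
    → (h₂ : C ↔ D) → IsSub (flipSum (Inverse.to f)) h₁ h₂
    → (h₃ : A ↔ B) → IsSub (Inverse.to f) h₂ h₃
    → (h₄ : C ↔ D) → IsSub (flipSum (Inverse.to f)) h₃ h₄
    → ((x : A) → Inverse.to h₃ x ≡ Inverse.to h₁ x)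
    × ((x : C) → Inverse.to h₄ x ≡ Inverse.to h₂ x)
proposition6 _ _ f g h₁ s₁ h₂ s₂ h₃ s₃ h₄ s₄ =
    sub-flip-sub (to f) f-inj h₁ (Loop-stop⁻¹ (s₁ _)) h₂ s₂ h₃ s₃
  , sub-flip-sub (flipSum (to f)) (flipSum-injective f-inj) h₂ (Loop-stop⁻¹ (s₂ _))
                 h₃ (IsSub-cong {h = h₃} (flipSum-involutive (to f)) s₃) h₄ s₄
  where
  f-inj : Injective _≡_ _≡_ (to f)
  f-inj = Injection.injective (↔⇒↣ f)
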